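{- Let $(X,\mathcal{H})$ be a hypothesis class which does not have finite Littlestone dimension. Then for every $d\in\mathbb{N}$, for all sufficiently large $T\in\mathbb{N}$ and every collection $\mathbf{A}$ of $\binom{T}{\le d}$ dynamic sets, there is a complete binary tree $\mathcal{T}$ of height $T$ with $X$-labeled internal nodes and some $h\in\mathcal{H}$ which realizes a branch of $\mathcal{T}$ not realized by any dynamic set from $\mathbf{A}$.
   Context: A hypothesis class is a pair $(X,\mathcal{H})$ with $\mathcal{H}\subseteq\mathcal{P}(X)$, each $h$ identified with its characteristic function $X\to\{0,1\}$. A binary tree of height $T$ with $X$-labeled internal nodes has internal nodes at levels $0,\dots,T-1$, each labeled by an element of $X$. A root-to-leaf path passing through nodes labeled $a_0,\dots,a_{T-1}$ and going in direction $t_i\in\{0,1\}$ ($0$ = left, $1$ = right) at node $i$ is realized by $h$ if $h(a_i)=t_i$ for all $i$. $\mathsf{Ldim}(\mathcal{H})$ is the largest depth of such a complete tree all of whose branches are realized by elements of $\mathcal{H}$. A dynamic set $\mathcal{A}$ is a function assigning a value in $\{0,1\}$ to every nonempty finite sequence $(a_0,\dots,a_\ell)$ of elements of $X$, $\ell<T$; in a tree it walks from the root, at a node labeled $a_\ell$ (reached via labels $a_0,\dots,a_{\ell-1}$) outputting $t_\ell=\mathcal{A}(a_0,\dots,a_\ell)$ and moving left if $t_\ell=0$, right if $t_\ell=1$. It realizes the branch it traverses. $\binom{T}{\le d}=\sum_{i=0}^d\binom{T}{i}$. -}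

module Defs where

open import Data.Nat using (ℕ; zero; suc; _+_)
open import Data.Nat.Combinatorics using (_C_)
open import Data.Bool using (Bool; true; false; if_then_else_)
open import Data.Fin using (Fin; zero; suc; toℕ)
open import Data.Vec using (Vec; []; _∷_)
open import Data.Product using (Σ; _×_; ∃)
open import Relation.Binary.PropositionalEquality using (_≡_)
open import Data.Unit using (⊤)

binom≤ : ℕ → ℕ → ℕ
binom≤ T zero    = T C 0
binom≤ T (suc d) = binom≤ T d + T C (suc d)

data Tree (X : Set) : ℕ → Set where
  leaf : Tree X 0
  node : {n : ℕ} → X → Tree X n → Tree X n → Tree X (suc n)

-- A branch is given by its sequence of directions (false = left, true = right).
Branch : ℕ → Set
Branch n = Vec Bool n

RealizesBranch : {X : Set} {n : ℕ} → (X → Bool) → Tree X n → Branch n → Set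
RealizesBranch h leaf         []       = ⊤
RealizesBranch h (node x l r) (b ∷ bs) = (h x ≡ b) × RealizesBranch h (if b then r else l) bs

Shattered : {X : Set} → ((X → Bool) → Set) → {n : ℕ} → Tree X n → Set
Shattered {X} H {n} t = (b : Branch n) → Σ (X → Bool) λ h → H h × RealizesBranch h t b

LdimInfinite : {X : Set} → ((X → Bool) → Set) → Set
LdimInfinite {X} H = (n : ℕ) → Σ (Tree X n) λ t → Shattered H t

-- Dynamic set for height T: value on every nonempty sequence (a_0,…,a_ℓ), ℓ < T.
DynSet : Set → ℕ → Set
DynSet X T = (ℓ : Fin T) → Vec X (suc (toℕ ℓ)) → Bool

walk : {X : Set} {n : ℕ} → Tree X n → DynSet X n → Branch n
walk leaf         A = []
walk (node x l r) A =
  A zero (x ∷ []) ∷ walk (if A zero (x ∷ []) then r else l) (λ ℓ v → A (suc ℓ) (x ∷ v))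

DynRealizes : {X : Set} {n : ℕ} → DynSet X n → Tree X n → Branch n → Set
DynRealizes A t b = walk t A ≡ b

-- A dynamic set realizes exactly one branch of a given tree, so
-- binom≤ T d dynamic sets realize at most binom≤ T d branches; by Pascal's rule
-- binom≤ T d < 2^T as soon as d < T, hence some branch is missed by all of them.
module Submission where

open import Defs
open import Data.Nat using (ℕ; zero; suc; _+_; _^_; _≤_; _<_; s≤s)
open import Data.Nat.Properties
open import Data.Nat.Combinatorics using (_C_; nCk+nC[k+1]≡[n+1]C[k+1])
open import Data.Nat.Tactic.RingSolver using (solve-∀)
open import Data.Bool using (Bool; true; false)
import Data.Bool.Properties as Bool
open import Data.Fin using (Fin)
open import Data.Vec using (Vec; []; _∷_)
open import Data.List using (List; []; _∷_; length; tabulate)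
open import Data.List.Properties using (length-tabulate)
open import Data.List.Relation.Unary.Any using (here; there)
open import Data.List.Membership.Propositional using (_∈_; _∉_)
open import Data.List.Membership.Propositional.Properties using (∈-tabulate⁺)
open import Data.Product using (Σ; ∃; _×_; _,_)
open import Function using (_∘_)
open import Relation.Nullary using (¬_; yes; no; contradiction)
open import Relation.Binary.PropositionalEquality using (_≡_; refl; sym; cong; cong₂; subst)
open import Relation.Binary.PropositionalEquality.Properties using (module ≡-Reasoning)

binom≤-zeroˡ : ∀ d → binom≤ 0 d ≡ 1
binom≤-zeroˡ zero    = refl
binom≤-zeroˡ (suc d) = cong (_+ 0) (binom≤-zeroˡ d)

binom≤-suc : ∀ T d → binom≤ (suc T) (suc d) ≡ binom≤ T (suc d) + binom≤ T d
binom≤-suc T zero = cong suc (begin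
  suc T C 1          ≡⟨ sym (nCk+nC[k+1]≡[n+1]C[k+1] T 0) ⟩
  T C 0 + T C 1      ≡⟨ +-comm 1 (T C 1) ⟩
  T C 1 + 1          ∎)
  where open ≡-Reasoning
binom≤-suc T (suc d) = begin
  binom≤ (suc T) (suc d) + suc T C suc (suc d)
    ≡⟨ cong₂ _+_ (binom≤-suc T d) (sym (nCk+nC[k+1]≡[n+1]C[k+1] T (suc d))) ⟩
  (binom≤ T (suc d) + binom≤ T d) + (T C suc d + T C suc (suc d))
    ≡⟨ regroup (binom≤ T (suc d)) (binom≤ T d) (T C suc d) (T C suc (suc d)) ⟩
  (binom≤ T (suc d) + T C suc (suc d)) + (binom≤ T d + T C suc d)
    ∎
  where
  open ≡-Reasoning
  regroup : ∀ a b c e → (a + b) + (c + e) ≡ (a + e) + (b + c)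
  regroup = solve-∀

-- 2 ^ suc T unfolds to 2 ^ T + (2 ^ T + 0).
binom≤≤2^ : ∀ T d → binom≤ T d ≤ 2 ^ T
binom≤≤2^ zero    d       = ≤-reflexive (binom≤-zeroˡ d)
binom≤≤2^ (suc T) zero    = m≤n⇒m≤n+o _ (binom≤≤2^ T zero)
binom≤≤2^ (suc T) (suc d) rewrite binom≤-suc T d =
  +-mono-≤ (binom≤≤2^ T (suc d)) (m≤n⇒m≤n+o 0 (binom≤≤2^ T d))

binom≤<2^ : ∀ T d → d < T → binom≤ T d < 2 ^ T
binom≤<2^ (suc T) zero    _         = +-mono-≤ (binom≤≤2^ T zero) (m≤n⇒m≤n+o 0 (binom≤≤2^ T zero))
binom≤<2^ (suc T) (suc d) (s≤s d<T) rewrite binom≤-suc T d =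
  +-mono-≤-< (binom≤≤2^ T (suc d)) (m≤n⇒m≤n+o 0 (binom≤<2^ T d d<T))

tails : ∀ {n} → Bool → List (Vec Bool (suc n)) → List (Vec Bool n)
tails b []             = []
tails b ((c ∷ v) ∷ L) with b Bool.≟ c
... | yes _ = v ∷ tails b L
... | no  _ = tails b L

length-tails : ∀ {n} (L : List (Vec Bool (suc n))) →
  length L ≡ length (tails true L) + length (tails false L)
length-tails []                 = refl
length-tails ((true  ∷ v) ∷ L) = cong suc (length-tails L)
length-tails ((false ∷ v) ∷ L) = begin
  suc (length L)                                           ≡⟨ cong suc (length-tails L) ⟩
  suc (length (tails true L) + length (tails false L))     ≡⟨ sym (+-suc _ _) ⟩
  length (tails true L) + suc (length (tails false L))     ∎
  where open ≡-Reasoning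

∈-tails : ∀ {n b} {v : Vec Bool n} {L} → b ∷ v ∈ L → v ∈ tails b L
∈-tails {b = b} (here refl) with b Bool.≟ b
... | yes _  = here refl
... | no b≢b = contradiction refl b≢b
∈-tails {b = b} {L = (c ∷ _) ∷ _} (there v∈L) with b Bool.≟ c
... | yes _ = there (∈-tails v∈L)
... | no  _ = ∈-tails v∈L

∃-tails-length< : ∀ {n} (L : List (Vec Bool (suc n))) → length L < 2 ^ suc n →
  ∃ λ b → length (tails b L) < 2 ^ n
∃-tails-length< {n} L |L|<2^[1+n]
  with length (tails true L) <? 2 ^ n | length (tails false L) <? 2 ^ n
... | yes short | _         = true , short
... | no  _     | yes short = false , short
... | no  long₁ | no  long₂ = contradiction |L|<2^[1+n] (≤⇒≯ (begin
  2 ^ n + (2 ^ n + 0)                               ≡⟨ cong (2 ^ n +_) (+-identityʳ (2 ^ n)) ⟩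
  2 ^ n + 2 ^ n                                     ≤⟨ +-mono-≤ (≮⇒≥ long₁) (≮⇒≥ long₂) ⟩
  length (tails true L) + length (tails false L)    ≡⟨ sym (length-tails L) ⟩
  length L                                          ∎))
  where open ≤-Reasoning

length<2^⇒∃∉ : ∀ n (L : List (Vec Bool n)) → length L < 2 ^ n → ∃ λ v → v ∉ L
length<2^⇒∃∉ zero    []      _                    = [] , λ ()
length<2^⇒∃∉ zero    (_ ∷ _) (s≤s ())
length<2^⇒∃∉ (suc n) L       |L|<2^[1+n]
  with b , short ← ∃-tails-length< L |L|<2^[1+n]
  with v , v∉ ← length<2^⇒∃∉ n (tails b L) short
  = b ∷ v , v∉ ∘ ∈-tails

∃-branch-missed : ∀ {X T m} (t : Tree X T) (𝐀 : Fin m → DynSet X T) → m < 2 ^ T →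
  ∃ λ b → (i : Fin m) → ¬ DynRealizes (𝐀 i) t b
∃-branch-missed {T = T} t 𝐀 m<2^T
  with b , b∉walks ← length<2^⇒∃∉ T (tabulate (walk t ∘ 𝐀))
                       (subst (_< 2 ^ T) (sym (length-tabulate _)) m<2^T)
  = b , λ i walk≡b → b∉walks (subst (_∈ _) walk≡b (∈-tabulate⁺ i))

lemma3p9 : (X : Set) (H : (X → Bool) → Set) → LdimInfinite H →
    (d : ℕ) → Σ ℕ λ T₀ → (T : ℕ) → T₀ ≤ T →
    (𝐀 : Fin (binom≤ T d) → DynSet X T) →
    Σ (Tree X T) λ t → Σ (X → Bool) λ h → Σ (Branch T) λ b →
    H h × RealizesBranch h t b × ((i : Fin (binom≤ T d)) → ¬ DynRealizes (𝐀 i) t b)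
lemma3p9 X H ldim d = suc d , λ T d<T 𝐀 →
  let t , shattered = ldim T
      b , missed    = ∃-branch-missed t 𝐀 (binom≤<2^ T d d<T)
      h , h∈H , h-realizes = shattered b
  in  t , h , b , h∈H , h-realizes , missed
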